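{- Let $S=\{a,b,c\}$ with $4\le a<b<c$ integers, $\gcd(a,b)=1$, and $c=ab-a-b$ (the Frobenius number of $\langle a,b\rangle$). Then $\langle S\rangle$ is greedy.
   Context: For a finite set $S=\{s_1<s_2<\dots<s_t\}$ of positive integers with $\gcd(s_1,\dots,s_t)=1$, let $\langle S\rangle=\{\sum_i\alpha_is_i:\alpha_i\in\mathbb{N}_0\}$ be the numerical semigroup it generates. For $k\in\langle S\rangle$, a representation of $k$ is a vector $(a_1,\dots,a_t)\in\mathbb{N}_0^t$ with $\sum_i a_is_i=k$; its cost is $\sum_i a_i$, and $\mathrm{MinCost}_S(k)$ is the minimum cost over all representations of $k$. The greedy representation of $k$ is produced as follows: set all $a_i=0$ and $i=t$; while $k>0$, let $q$ be the largest nonnegative integer such that $k=qs_i+r$ with $r\in\langle S\rangle$, set $a_i=q$, $k\leftarrow r$, $i\leftarrow i-1$. $\mathrm{GreedyCost}_S(k)$ is the cost of the greedy representation. The semigroup $\langle S\rangle$ is called greedy if $\mathrm{GreedyCost}_S(k)=\mathrm{MinCost}_S(k)$ for every $k\in\langle S\rangle$. -}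

module Defs where

open import Data.Nat using (ℕ; zero; suc; _+_; _*_; _∸_; _≤_; _<_)
open import Data.Vec using (Vec; []; _∷_; zipWith; sum; reverse)
open import Data.Product using (Σ; ∃; _×_; _,_)
open import Relation.Binary.PropositionalEquality using (_≡_)
open import Relation.Nullary using (¬_)

-- A generating set S = {s₁ < … < sₜ} is given as the vector (s₁ , … , sₜ).
-- A representation of k is a vector (a₁ , … , aₜ) with Σ aᵢ sᵢ = k.
dot : ∀ {t} → Vec ℕ t → Vec ℕ t → ℕ
dot S r = sum (zipWith _*_ S r)

IsRep : ∀ {t} → Vec ℕ t → ℕ → Vec ℕ t → Set
IsRep S k r = dot S r ≡ k

InSG : ∀ {t} → Vec ℕ t → ℕ → Set
InSG {t} S k = Σ (Vec ℕ t) (IsRep S k)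

cost : ∀ {t} → Vec ℕ t → ℕ
cost r = sum r

IsMinCost : ∀ {t} → Vec ℕ t → ℕ → ℕ → Set
IsMinCost {t} S k m =
  (Σ (Vec ℕ t) λ r → IsRep S k r × cost r ≡ m) ×
  ((r : Vec ℕ t) → IsRep S k r → m ≤ cost r)

IsMaxQuot : ∀ {t} → Vec ℕ t → ℕ → ℕ → ℕ → Set
IsMaxQuot S s k q =
  (q * s ≤ k × InSG S (k ∸ q * s)) ×
  ((q' : ℕ) → q < q' → q' * s ≤ k → ¬ InSG S (k ∸ q' * s))

-- Greedy steps.  'GreedySteps S gs k qs': processing the generators gs
-- (listed from the current index downwards, i.e. sᵢ, sᵢ₋₁, …, s₁) starting
-- from remainder k produces the coefficients qs (aᵢ, aᵢ₋₁, …, a₁), where at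
-- each step the coefficient is the maximal quotient (membership is always in
-- the full semigroup ⟨S⟩).  When k = 0 the maximal quotient is 0, matching
-- the "while k > 0" loop which leaves the remaining aᵢ = 0.  The algorithm
-- terminates with remainder 0.
data GreedySteps {t} (S : Vec ℕ t) : ∀ {m} → Vec ℕ m → ℕ → Vec ℕ m → Set where
  done : GreedySteps S [] 0 []
  step : ∀ {m} {s k q} {gs : Vec ℕ m} {qs : Vec ℕ m} →
         IsMaxQuot S s k q →
         GreedySteps S gs (k ∸ q * s) qs →
         GreedySteps S (s ∷ gs) k (q ∷ qs)

IsGreedyRep : ∀ {t} → Vec ℕ t → ℕ → Vec ℕ t → Set
IsGreedyRep S k r = GreedySteps S (reverse S) k (reverse r)

IsGreedyCost : ∀ {t} → Vec ℕ t → ℕ → ℕ → Set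
IsGreedyCost {t} S k m = Σ (Vec ℕ t) λ r → IsGreedyRep S k r × cost r ≡ m

IsGreedy : ∀ {t} → Vec ℕ t → Set
IsGreedy S = ∀ k → InSG S k →
  (∃ λ m → IsGreedyCost S k m) ×
  (∀ m → IsGreedyCost S k m → IsMinCost S k m)

-- Greedy always succeeds: membership in ⟨a, b, c⟩ is decidable, so maximal
-- quotients exist, and the final remainder is 0 because any generator it
-- contained would have enlarged an earlier quotient.  For optimality let
-- (x, y, z) be the greedy representation.  Maximality of z gives z' ≤ z for
-- every representation (x', y', z'), and since a·b = c + a + b, a copies of b
-- could be traded for one more c, so y < a; likewise b copies of a are a
-- copies of b, so x < b.  Writing z = z' + d, the relation c = ab − a − b
-- turns the two representations into a·x + b·y + d·ab = a(x' + d) + b(y' + d).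
-- As gcd(a, b) = 1 with x < b and y < a, the excess P, Q of the right-hand
-- coefficients is nonnegative and satisfies d·ab = aP + bQ ≤ b(P + Q), so
-- P + Q ≥ da ≥ 3d, which is exactly what the cost comparison needs.
module Submission where

open import Defs
open import Data.Nat
  using (ℕ; zero; suc; _+_; _*_; _∸_; _≤_; _<_; z≤n; s≤s; z<s; NonZero; >-nonZero; >-nonZero⁻¹; ≢-nonZero⁻¹; _≤?_; _≟_; anyUpTo?)
open import Data.Nat.Properties
open import Data.Nat.GCD using (gcd)
open import Data.Nat.Divisibility using (_∣_; ∣⇒≤; ∣m+n∣m⇒∣n; m∣m*n)
open import Data.Nat.Coprimality as Coprime using (Coprime; gcd≡1⇒coprime; coprime-divisor)
open import Data.Nat.Tactic.RingSolver using (solve-∀)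
open import Data.Vec using (Vec; []; _∷_)
open import Data.Product using (∃; _×_; _,_; proj₁; proj₂; curry)
open import Data.Sum using (inj₁; inj₂)
open import Function using (_∘_)
open import Data.Empty using (⊥; ⊥-elim)
open import Relation.Binary.PropositionalEquality
open import Relation.Nullary using (¬_; yes; no; contradiction)
open import Relation.Nullary.Decidable using (map′; _×-dec_)
open import Relation.Unary using (Pred; Decidable)

InSG-∷⁻ : ∀ {t} s (S : Vec ℕ t) {n} → InSG (s ∷ S) n →
          ∃ λ x → x < suc n × s * x ≤ n × InSG S (n ∸ s * x)
InSG-∷⁻ zero      S (x ∷ r , refl) = 0 , z<s , z≤n , r , refl
InSG-∷⁻ s@(suc _) S (x ∷ r , refl) =
  x , s≤s (≤-trans (m≤n*m x s) (m≤m+n (s * x) _)) , m≤m+n (s * x) _ ,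
  r , sym (m+n∸m≡n (s * x) _)

InSG-∷⁺ : ∀ {t} s (S : Vec ℕ t) {n x} → s * x ≤ n → InSG S (n ∸ s * x) → InSG (s ∷ S) n
InSG-∷⁺ s S {x = x} sx≤n (r , r≡n∸sx) = x ∷ r , trans (cong (s * x +_) r≡n∸sx) (m+[n∸m]≡n sx≤n)

inSG? : ∀ {t} (S : Vec ℕ t) → Decidable (InSG S)
inSG? []      n = map′ ([] ,_) (λ { ([] , 0≡n) → 0≡n }) (0 ≟ n)
inSG? (s ∷ S) n =
  map′ (λ (_ , _ , sx≤n , r) → InSG-∷⁺ s S sx≤n r) (InSG-∷⁻ s S)
       (anyUpTo? (λ x → (s * x ≤? n) ×-dec inSG? S (n ∸ s * x)) (suc n))

greatest : ∀ {p} {P : Pred ℕ p} → Decidable P → P 0 → ∀ B → (∀ q → B < q → ¬ P q) →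
           ∃ λ q → P q × (∀ q' → q < q' → ¬ P q')
greatest P? P0 zero    bounded = 0 , P0 , bounded
greatest P? P0 (suc B) bounded with P? (suc B)
... | yes P[1+B] = suc B , P[1+B] , bounded
... | no ¬P[1+B] = greatest P? P0 B bounded′
  where
  bounded′ : ∀ q → B < q → ¬ _
  bounded′ q B<q with m≤n⇒m<n∨m≡n B<q
  ... | inj₁ 1+B<q = bounded q 1+B<q
  ... | inj₂ refl  = ¬P[1+B]

maxQuot-exists : ∀ {t} (S : Vec ℕ t) s .{{_ : NonZero s}} k → InSG S k → ∃ (IsMaxQuot S s k)
maxQuot-exists S s k k∈S =
  let q , divisible , maximal = greatest (λ q → (q * s ≤? k) ×-dec inSG? S (k ∸ q * s)) (z≤n , k∈S) k exceeds
  in  q , divisible , λ q' q<q' → curry (maximal q' q<q')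
  where
  exceeds : ∀ q → k < q → ¬ (q * s ≤ k × InSG S (k ∸ q * s))
  exceeds q k<q (qs≤k , _) = <⇒≱ k<q (≤-trans (m≤m*n q s) qs≤k)

maxQuot-greatest : ∀ {t} {S : Vec ℕ t} {s k q q' m} → IsMaxQuot S s k q →
                   InSG S m → q' * s + m ≡ k → q' ≤ q
maxQuot-greatest {S = S} {s} {q = q} {q'} {m} (_ , maximal) m∈S refl with q' ≤? q
... | yes q'≤q = q'≤q
... | no  q'≰q = contradiction (subst (InSG S) (sym (m+n∸m≡n (q' * s) m)) m∈S)
                               (maximal q' (≰⇒> q'≰q) (m≤m+n _ _))

maxQuot-remainder≢s+ : ∀ {t} {S : Vec ℕ t} {s k q m} → IsMaxQuot S s k q →
                       InSG S m → k ∸ q * s ≡ s + m → ⊥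
maxQuot-remainder≢s+ {S = S} {s} {k} {q} {m} mq@((qs≤k , _) , _) m∈S remainder≡s+m =
  1+n≰n (maxQuot-greatest {S = S} mq m∈S (begin
    (s + q * s) + m   ≡⟨ cong (_+ m) (+-comm s (q * s)) ⟩
    (q * s + s) + m   ≡⟨ +-assoc (q * s) s m ⟩
    q * s + (s + m)   ≡⟨ cong (q * s +_) remainder≡s+m ⟨
    q * s + (k ∸ q * s) ≡⟨ m+[n∸m]≡n qs≤k ⟩
    k                 ∎))
  where open ≡-Reasoning

greedySteps-dot : ∀ {t m} {S : Vec ℕ t} {gs : Vec ℕ m} {k qs} → GreedySteps S gs k qs → dot gs qs ≡ k
greedySteps-dot done = refl
greedySteps-dot {gs = s ∷ gs} {k} {q ∷ qs} (step ((qs≤k , _) , _) steps) = begin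
  s * q + dot gs qs    ≡⟨ cong₂ _+_ (*-comm s q) (greedySteps-dot steps) ⟩
  q * s + (k ∸ q * s)  ≡⟨ m+[n∸m]≡n qs≤k ⟩
  k                    ∎
  where open ≡-Reasoning

coprime-coefficient-≤ : ∀ {a b x X m n} → Coprime a b → x < b →
                        a * x + b * m ≡ a * X + b * n → x ≤ X
coprime-coefficient-≤ {a} {b} {x} {X} {m} {n} coprime x<b eq with x ≤? X
... | yes x≤X = x≤X
... | no  x≰X with m≤n⇒∃[o]m+o≡n (≰⇒> x≰X)
...   | o , refl = contradiction (≤-trans b≤1+o (s≤s (m≤n+m o X))) (<⇒≱ x<b)
  where
  shifted : b * m + a * suc o ≡ b * n
  shifted = +-cancelˡ-≡ (a * X) _ _ (trans (rearrange a b X o m) eq)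
    where
    rearrange : ∀ a b X o m → a * X + (b * m + a * suc o) ≡ a * (suc X + o) + b * m
    rearrange = solve-∀
  b≤1+o : b ≤ suc o
  b≤1+o = ∣⇒≤ (coprime-divisor (Coprime.sym coprime)
                 (∣m+n∣m⇒∣n (subst (b ∣_) (sym shifted) (m∣m*n n)) (m∣m*n m)))

reduced-cost-≤ : ∀ {a b x y d X Y} → Coprime a b → a ≤ b → x < b → y < a →
                 a * x + b * y + d * (a * b) ≡ a * X + b * Y → x + y + d * a ≤ X + Y
reduced-cost-≤ {a} {b} {x} {y} {d} {X} {Y} coprime a≤b x<b y<a eq
  with m≤n⇒∃[o]m+o≡n (coprime-coefficient-≤ coprime x<b eqˣ)
     | m≤n⇒∃[o]m+o≡n (coprime-coefficient-≤ (Coprime.sym coprime) y<a eqʸ)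
  where
  eqˣ : a * x + b * (y + d * a) ≡ a * X + b * Y
  eqˣ = trans (rearrange a b x y d) eq
    where
    rearrange : ∀ a b x y d → a * x + b * (y + d * a) ≡ a * x + b * y + d * (a * b)
    rearrange = solve-∀
  eqʸ : b * y + a * (x + d * b) ≡ b * Y + a * X
  eqʸ = trans (rearrange a b x y d) (trans eq (+-comm (a * X) (b * Y)))
    where
    rearrange : ∀ a b x y d → b * y + a * (x + d * b) ≡ a * x + b * y + d * (a * b)
    rearrange = solve-∀
... | P , refl | Q , refl = begin
  x + y + d * a        ≤⟨ +-monoʳ-≤ (x + y) da≤P+Q ⟩
  x + y + (P + Q)      ≡⟨ rearrange x y P Q ⟩
  x + P + (y + Q)      ∎
  where
  open ≤-Reasoning
  rearrange : ∀ x y P Q → x + y + (P + Q) ≡ x + P + (y + Q)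
  rearrange = solve-∀
  excess : b * (d * a) ≡ a * P + b * Q
  excess = +-cancelˡ-≡ (a * x + b * y) _ _ (begin-equality
    a * x + b * y + b * (d * a)    ≡⟨ split₁ a b x y d ⟩
    a * x + b * y + d * (a * b)    ≡⟨ eq ⟩
    a * (x + P) + b * (y + Q)      ≡⟨ split₂ a b x y P Q ⟩
    a * x + b * y + (a * P + b * Q) ∎)
    where
    split₁ : ∀ a b x y d → a * x + b * y + b * (d * a) ≡ a * x + b * y + d * (a * b)
    split₁ = solve-∀
    split₂ : ∀ a b x y P Q → a * (x + P) + b * (y + Q) ≡ a * x + b * y + (a * P + b * Q)
    split₂ = solve-∀
  instance
    b≢0 : NonZero b
    b≢0 = >-nonZero (≤-<-trans z≤n x<b)
  da≤P+Q : d * a ≤ P + Q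
  da≤P+Q = *-cancelˡ-≤ b (begin
    b * (d * a)        ≡⟨ excess ⟩
    a * P + b * Q      ≤⟨ +-monoˡ-≤ (b * Q) (*-monoˡ-≤ P a≤b) ⟩
    b * P + b * Q      ≡⟨ *-distribˡ-+ b P Q ⟨
    b * (P + Q)        ∎)

frobenius-cost-≤ : ∀ {a b c x y z x' y' z'} → c + a + b ≡ a * b → Coprime a b → 3 ≤ a → a ≤ b →
                   x < b → y < a → z' ≤ z →
                   dot (a ∷ b ∷ c ∷ []) (x ∷ y ∷ z ∷ []) ≡ dot (a ∷ b ∷ c ∷ []) (x' ∷ y' ∷ z' ∷ []) →
                   cost (x ∷ y ∷ z ∷ []) ≤ cost (x' ∷ y' ∷ z' ∷ [])
frobenius-cost-≤ {a} {b} {c} {x} {y} {z} {x'} {y'} {z'} c+a+b≡ab coprime 3≤a a≤b x<b y<a z'≤z eq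
  with m≤n⇒∃[o]m+o≡n z'≤z
... | d , refl = +-cancelʳ-≤ (d + d) _ _ (begin
  x + (y + (z' + d + 0)) + (d + d)  ≡⟨ regroup₁ x y z' d ⟩
  x + y + d * 3 + z'                ≤⟨ +-monoˡ-≤ z' (+-monoʳ-≤ (x + y) (*-monoʳ-≤ d 3≤a)) ⟩
  x + y + d * a + z'                ≤⟨ +-monoˡ-≤ z' (reduced-cost-≤ {d = d} coprime a≤b x<b y<a shifted) ⟩
  x' + d + (y' + d) + z'            ≡⟨ regroup₂ x' y' z' d ⟩
  x' + (y' + (z' + 0)) + (d + d)    ∎)
  where
  open ≤-Reasoning
  regroup₁ : ∀ x y z' d → x + (y + (z' + d + 0)) + (d + d) ≡ x + y + d * 3 + z'
  regroup₁ = solve-∀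
  regroup₂ : ∀ x' y' z' d → x' + d + (y' + d) + z' ≡ x' + (y' + (z' + 0)) + (d + d)
  regroup₂ = solve-∀
  shifted : a * x + b * y + d * (a * b) ≡ a * (x' + d) + b * (y' + d)
  shifted = +-cancelʳ-≡ (c * z') _ _ (begin-equality
    a * x + b * y + d * (a * b) + c * z'               ≡⟨ cong (λ ab → a * x + b * y + d * ab + c * z') c+a+b≡ab ⟨
    a * x + b * y + d * (c + a + b) + c * z'           ≡⟨ expand a b c x y z' d ⟩
    a * x + (b * y + (c * (z' + d) + 0)) + (d * a + d * b) ≡⟨ cong (_+ (d * a + d * b)) eq ⟩
    a * x' + (b * y' + (c * z' + 0)) + (d * a + d * b)  ≡⟨ collect a b c x' y' z' d ⟩
    a * (x' + d) + b * (y' + d) + c * z'               ∎)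
    where
    expand : ∀ a b c x y z' d →
             a * x + b * y + d * (c + a + b) + c * z' ≡ a * x + (b * y + (c * (z' + d) + 0)) + (d * a + d * b)
    expand = solve-∀
    collect : ∀ a b c x' y' z' d →
              a * x' + (b * y' + (c * z' + 0)) + (d * a + d * b) ≡ a * (x' + d) + b * (y' + d) + c * z'
    collect = solve-∀

module ThreeGenerators (a b c : ℕ) {{_ : NonZero a}} {{_ : NonZero b}} {{_ : NonZero c}} where

  S : Vec ℕ 3
  S = a ∷ b ∷ c ∷ []

  greedy-remainder≡0 : ∀ {k z y x} → IsMaxQuot S c k z → IsMaxQuot S b (k ∸ z * c) y →
                       IsMaxQuot S a (k ∸ z * c ∸ y * b) x →
                       InSG S (k ∸ z * c ∸ y * b ∸ x * a) → k ∸ z * c ∸ y * b ∸ x * a ≡ 0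
  greedy-remainder≡0 {k} {z} {y} {x} mz@((zc≤k , _) , _) my@((yb≤R , _) , _) mx@((xa≤R′ , _) , _) (r , r≡R″)
    = remainder≡0 r r≡R″
    where
    open ≡-Reasoning
    R  = k ∸ z * c
    R′ = R ∸ y * b
    R″ = R′ ∸ x * a
    remainder≡0 : ∀ r → dot S r ≡ R″ → R″ ≡ 0
    remainder≡0 (suc u ∷ v ∷ w ∷ []) r≡R″ = contradiction
      (begin
        R″                              ≡⟨ r≡R″ ⟨
        a * suc u + (b * v + (c * w + 0)) ≡⟨ split a b c u v w ⟩
        a + (a * u + (b * v + (c * w + 0))) ∎)
      (maxQuot-remainder≢s+ {S = S} mx (u ∷ v ∷ w ∷ [] , refl))
      where
      split : ∀ a b c u v w → a * (1 + u) + (b * v + (c * w + 0)) ≡ a + (a * u + (b * v + (c * w + 0)))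
      split = solve-∀
    remainder≡0 (0 ∷ suc v ∷ w ∷ []) r≡R″ = contradiction
      (begin
        R′                                        ≡⟨ m+[n∸m]≡n xa≤R′ ⟨
        x * a + R″                                ≡⟨ cong (x * a +_) r≡R″ ⟨
        x * a + (a * 0 + (b * suc v + (c * w + 0))) ≡⟨ split a b c x v w ⟩
        b + (a * x + (b * v + (c * w + 0)))         ∎)
      (maxQuot-remainder≢s+ {S = S} my (x ∷ v ∷ w ∷ [] , refl))
      where
      split : ∀ a b c x v w → x * a + (a * 0 + (b * (1 + v) + (c * w + 0))) ≡ b + (a * x + (b * v + (c * w + 0)))
      split = solve-∀
    remainder≡0 (0 ∷ 0 ∷ suc w ∷ []) r≡R″ = contradiction
      (begin
        R                                                  ≡⟨ m+[n∸m]≡n yb≤R ⟨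
        y * b + R′                                         ≡⟨ cong (y * b +_) (m+[n∸m]≡n xa≤R′) ⟨
        y * b + (x * a + R″)                               ≡⟨ cong (λ n → y * b + (x * a + n)) r≡R″ ⟨
        y * b + (x * a + (a * 0 + (b * 0 + (c * suc w + 0)))) ≡⟨ split a b c x y w ⟩
        c + (a * x + (b * y + (c * w + 0)))                  ∎)
      (maxQuot-remainder≢s+ {S = S} mz (x ∷ y ∷ w ∷ [] , refl))
      where
      split : ∀ a b c x y w →
              y * b + (x * a + (a * 0 + (b * 0 + (c * (1 + w) + 0)))) ≡ c + (a * x + (b * y + (c * w + 0)))
      split = solve-∀
    remainder≡0 (0 ∷ 0 ∷ 0 ∷ []) r≡R″ = trans (sym r≡R″) (zero-rep a b c)
      where
      zero-rep : ∀ a b c → a * 0 + (b * 0 + (c * 0 + 0)) ≡ 0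
      zero-rep = solve-∀

  greedyRep-exists : ∀ k → InSG S k → ∃ (IsGreedyRep S k)
  greedyRep-exists k k∈S =
    let z , mz = maxQuot-exists S c k k∈S
        y , my = maxQuot-exists S b (k ∸ z * c) (proj₂ (proj₁ mz))
        x , mx = maxQuot-exists S a (k ∸ z * c ∸ y * b) (proj₂ (proj₁ my))
        R″≡0   = greedy-remainder≡0 mz my mx (proj₂ (proj₁ mx))
    in  x ∷ y ∷ z ∷ [] ,
        step mz (step my (step mx (subst (λ n → GreedySteps S [] n []) (sym R″≡0) done)))

  greedy-x<b : ∀ {R y x} → IsMaxQuot S b R y → b * y + (a * x + 0) ≡ R → x < b
  greedy-x<b {R} {y} {x} my R≡ with b ≤? x
  ... | no  b≰x = ≰⇒> b≰x
  ... | yes b≤x with m≤n⇒∃[o]m+o≡n b≤x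
  ...   | x₀ , refl = contradiction
          (maxQuot-greatest {S = S} my (x₀ ∷ 0 ∷ 0 ∷ [] , refl) (trans (trade a b c y x₀) R≡))
          (<⇒≱ (m<m+n y (>-nonZero⁻¹ a)))
    where
    trade : ∀ a b c y x₀ → (y + a) * b + (a * x₀ + (b * 0 + (c * 0 + 0))) ≡ b * y + (a * (b + x₀) + 0)
    trade = solve-∀

  greedy-z-greatest : ∀ {k z x' y' z'} → IsMaxQuot S c k z → IsRep S k (x' ∷ y' ∷ z' ∷ []) → z' ≤ z
  greedy-z-greatest {x' = x'} {y'} {z'} mz rep =
    maxQuot-greatest {S = S} mz (x' ∷ y' ∷ 0 ∷ [] , refl) (trans (split a b c x' y' z') rep)
    where
    split : ∀ a b c x' y' z' → z' * c + (a * x' + (b * y' + (c * 0 + 0))) ≡ a * x' + (b * y' + (c * z' + 0))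
    split = solve-∀

  module Frobenius (c+a+b≡ab : c + a + b ≡ a * b) (coprime : Coprime a b) (3≤a : 3 ≤ a) (a≤b : a ≤ b) where

    greedy-y<a : ∀ {k z y x} → IsMaxQuot S c k z → b * y + (a * x + 0) ≡ k ∸ z * c → y < a
    greedy-y<a {k} {z} {y} {x} mz R≡ with a ≤? y
    ... | no  a≰y = ≰⇒> a≰y
    ... | yes a≤y with m≤n⇒∃[o]m+o≡n a≤y
    ...   | y₀ , refl = ⊥-elim (maxQuot-remainder≢s+ {S = S} mz (suc x ∷ suc y₀ ∷ 0 ∷ [] , refl) (begin
            k ∸ z * c                                     ≡⟨ R≡ ⟨
            b * (a + y₀) + (a * x + 0)                    ≡⟨ split a b x y₀ ⟩
            a * b + (a * x + b * y₀)                      ≡⟨ cong (_+ (a * x + b * y₀)) c+a+b≡ab ⟨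
            c + a + b + (a * x + b * y₀)                  ≡⟨ trade a b c x y₀ ⟩
            c + (a * suc x + (b * suc y₀ + (c * 0 + 0)))  ∎))
      where
      open ≡-Reasoning
      split : ∀ a b x y₀ → b * (a + y₀) + (a * x + 0) ≡ a * b + (a * x + b * y₀)
      split = solve-∀
      trade : ∀ a b c x y₀ → c + a + b + (a * x + b * y₀) ≡ c + (a * (1 + x) + (b * (1 + y₀) + (c * 0 + 0)))
      trade = solve-∀

    greedyCost-isMinCost : ∀ k m → IsGreedyCost S k m → IsMinCost S k m
    greedyCost-isMinCost k m (x ∷ y ∷ z ∷ [] , greedy@(step mz inner@(step my _)) , cost≡m) =
      (x ∷ y ∷ z ∷ [] , rep , cost≡m) ,
      λ { (x' ∷ y' ∷ z' ∷ []) rep' →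
          subst (_≤ _) cost≡m
            (frobenius-cost-≤ c+a+b≡ab coprime 3≤a a≤b
              (greedy-x<b my R≡) (greedy-y<a mz R≡) (greedy-z-greatest mz rep') (trans rep (sym rep'))) }
      where
      R≡ : b * y + (a * x + 0) ≡ k ∸ z * c
      R≡ = greedySteps-dot inner
      rep : IsRep S k (x ∷ y ∷ z ∷ [])
      rep = trans (reverse-dot a b c x y z) (greedySteps-dot greedy)
        where
        reverse-dot : ∀ a b c x y z → a * x + (b * y + (c * z + 0)) ≡ c * z + (b * y + (a * x + 0))
        reverse-dot = solve-∀

theorem5 : (a b c : ℕ) → 4 ≤ a → a < b → b < c → gcd a b ≡ 1 →
           c ≡ a * b ∸ a ∸ b → IsGreedy (a ∷ b ∷ c ∷ [])
theorem5 a b c 4≤a a<b b<c gcd≡1 c≡ab∸a∸b k k∈S =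
  (let r , greedy = greedyRep-exists k k∈S in cost r , r , greedy , refl) ,
  greedyCost-isMinCost k
  where
  instance
    a≢0 : NonZero a
    a≢0 = >-nonZero (<-≤-trans z<s 4≤a)
    b≢0 : NonZero b
    b≢0 = >-nonZero (<-trans (>-nonZero⁻¹ a) a<b)
    c≢0 : NonZero c
    c≢0 = >-nonZero (<-trans (>-nonZero⁻¹ b) b<c)
  c≡ab∸[a+b] : c ≡ a * b ∸ (a + b)
  c≡ab∸[a+b] = trans c≡ab∸a∸b (∸-+-assoc (a * b) a b)
  c+a+b≡ab : c + a + b ≡ a * b
  c+a+b≡ab = begin
    c + a + b              ≡⟨ +-assoc c a b ⟩
    c + (a + b)            ≡⟨ cong (_+ (a + b)) c≡ab∸[a+b] ⟩
    a * b ∸ (a + b) + (a + b) ≡⟨ m∸n+n≡m (<⇒≤ (m∸n≢0⇒n<m {a * b} {a + b} (≢-nonZero⁻¹ c ∘ trans c≡ab∸[a+b]))) ⟩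
    a * b                  ∎
    where open ≡-Reasoning
  open ThreeGenerators a b c
  open Frobenius c+a+b≡ab (gcd≡1⇒coprime gcd≡1) (≤-trans (n≤1+n 3) 4≤a) (<⇒≤ a<b)
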